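{- Let $\mathcal A=(Q,\Sigma,\delta,s,F)$ be a DFA satisfying the standing assumptions below. Then for any $u,v\in Q$ with $u\neq v$: $u<_{\mathcal A}v$ if and only if $\sup I_u\le\inf I_v$.
   Context: A DFA is $\mathcal A=(Q,\Sigma,\delta,s,F)$ with finite state set $Q$, finite totally ordered alphabet $\Sigma$, (partial) transition function $\delta$, initial state $s$, final states $F$; $\delta$ extended to words as usual. Standing assumptions: $s$ has no incoming transitions; every state is reachable from $s$; all transitions entering a given state carry the same label. $I_q=\{\alpha\in\Sigma^*:\delta(s,\alpha)=q\}$. Strings may be finite or left-infinite $\omega$-strings. Co-lex order on $\Sigma^*\cup\Sigma^\omega$: $\epsilon<\alpha$ for nonempty $\alpha$; for $\alpha=\alpha'a$, $\beta=\beta'b$ with $a,b\in\Sigma$, $\alpha<\beta$ iff $a<b$, or $a=b$ and $\alpha'<\beta'$. $\inf I_u$, $\sup I_u$ are the greatest lower bound and least upper bound of $I_u$ in $(\Sigma^*\cup\Sigma^\omega,\le)$. The relation $<_{\mathcal A}$ on $Q$ is defined by $u<_{\mathcal A}v$ iff $\alpha<\beta$ for all $\alpha\in I_u$ and all $\beta\in I_v$. -}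

module Defs where

open import Data.Nat using (ℕ; zero; suc) renaming (_<_ to _<ℕ_)
open import Data.Fin using (Fin) renaming (_<_ to _<F_)
open import Data.List using (List; []; _∷_; reverse)
open import Data.Maybe using (Maybe; just; nothing; _>>=_)
open import Data.Bool using (Bool)
open import Data.Product using (Σ; ∃; _×_; _,_)
open import Data.Sum using (_⊎_)
open import Data.Empty using (⊥)
open import Relation.Binary.PropositionalEquality using (_≡_; _≢_)
open import Function.Bundles using (_⇔_)

-- Alphabet: a finite totally ordered alphabet is (up to order-isomorphism)
-- Fin σ with its natural order.

Letter : ℕ → Set
Letter σ = Fin σ

-- Finite strings and left-infinite ω-strings are
-- represented "read from the right end": position 0 is the LAST letter,
-- position 1 the second-to-last, etc.
--   fin w : finite string whose letters, read right-to-left, are w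
--           (so the ordinary word α is  fin (reverse α))
--   inf f : left-infinite string  ... f 2 f 1 f 0

data Str (σ : ℕ) : Set where
  fin : List (Letter σ) → Str σ
  inf : (ℕ → Letter σ) → Str σ

lookupL : ∀ {A : Set} → List A → ℕ → Maybe A
lookupL []       _       = nothing
lookupL (x ∷ xs) zero    = just x
lookupL (x ∷ xs) (suc i) = lookupL xs i

at : ∀ {σ} → Str σ → ℕ → Maybe (Letter σ)
at (fin w) i = lookupL w i
at (inf f) i = just (f i)

word : ∀ {σ} → List (Letter σ) → Str σ
word α = fin (reverse α)

data FirstDiff {σ} : Maybe (Letter σ) → Maybe (Letter σ) → Set where
  ended : ∀ {b} → FirstDiff nothing (just b)
  less  : ∀ {a b} → a <F b → FirstDiff (just a) (just b)

-- co-lex strict order: ε < nonempty; α'a < β'b iff a < b or (a = b and α' < β')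
_<co_ : ∀ {σ} → Str σ → Str σ → Set
x <co y = ∃ λ k → (∀ i → i <ℕ k → at x i ≡ at y i) × FirstDiff (at x k) (at y k)

_≈co_ : ∀ {σ} → Str σ → Str σ → Set
x ≈co y = ∀ i → at x i ≡ at y i

_≤co_ : ∀ {σ} → Str σ → Str σ → Set
x ≤co y = x <co y ⊎ x ≈co y

IsUpperBound : ∀ {σ} → (Str σ → Set) → Str σ → Set
IsUpperBound S x = ∀ y → S y → y ≤co x

IsLowerBound : ∀ {σ} → (Str σ → Set) → Str σ → Set
IsLowerBound S x = ∀ y → S y → x ≤co y

IsSup : ∀ {σ} → (Str σ → Set) → Str σ → Set
IsSup S x = IsUpperBound S x × (∀ y → IsUpperBound S y → x ≤co y)

IsInf : ∀ {σ} → (Str σ → Set) → Str σ → Set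
IsInf S x = IsLowerBound S x × (∀ y → IsLowerBound S y → y ≤co x)

record DFA (n σ : ℕ) : Set where
  field
    δ : Fin n → Letter σ → Maybe (Fin n)
    s : Fin n
    F : Fin n → Bool

  δ* : Fin n → List (Letter σ) → Maybe (Fin n)
  δ* q []       = just q
  δ* q (a ∷ α)  = δ q a >>= λ q' → δ* q' α

  I : Fin n → List (Letter σ) → Set
  I q α = δ* s α ≡ just q

  IStr : Fin n → Str σ → Set
  IStr q x = ∃ λ α → I q α × x ≡ word α

  _<A_ : Fin n → Fin n → Set
  u <A v = ∀ α β → I u α → I v β → word α <co word β

record Standing {n σ} (A : DFA n σ) : Set where
  open DFA A
  field
    s-no-incoming : ∀ q a → δ q a ≢ just s
    reachable     : ∀ q → ∃ λ α → δ* s α ≡ just q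
    input-consistent : ∀ q q' a a' r → δ q a ≡ just r → δ q' a' ≡ just r → a ≡ a'

module Submission where

open import Defs
open import Data.Nat using (suc)
open import Data.Nat.Properties using (<-cmp; <-trans)
open import Data.Fin using (Fin)
import Data.Fin.Properties as Finₚ
open import Data.List using (List; []; _∷_; reverse)
open import Data.List.Properties using (reverse-injective)
open import Data.Maybe using (Maybe; just)
open import Data.Maybe.Properties using (just-injective)
open import Data.Product using (_,_)
open import Data.Sum using (inj₁; inj₂)
open import Data.Empty using (⊥-elim)
open import Relation.Binary using (tri<; tri≈; tri>)
open import Relation.Binary.PropositionalEquality using (_≡_; _≢_; refl; sym; trans; cong; subst)
open import Function.Bundles using (_⇔_; mk⇔)

-- As δ is deterministic, I_u and I_v are disjoint, so for α ∈ I_u and β ∈ I_v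
-- the chain α ≤ sup I_u ≤ inf I_v ≤ β cannot collapse to equality and is
-- strict.  Conversely, if every α ∈ I_u lies below every β ∈ I_v, then
-- sup I_u ≤ inf I_v by the extremal properties of sup and inf.

FirstDiff-trans : ∀ {σ} {a b c : Maybe (Fin σ)} → FirstDiff a b → FirstDiff b c → FirstDiff a c
FirstDiff-trans ended    (less _) = ended
FirstDiff-trans (less p) (less q) = less (Finₚ.<-trans p q)

<co-trans : ∀ {σ} {x y z : Str σ} → x <co y → y <co z → x <co z
<co-trans (k₁ , e₁ , d₁) (k₂ , e₂ , d₂) with <-cmp k₁ k₂
... | tri< k₁<k₂ _ _ =
  k₁ , (λ i i<k₁ → trans (e₁ i i<k₁) (e₂ i (<-trans i<k₁ k₁<k₂))) ,
  subst (FirstDiff _) (e₂ k₁ k₁<k₂) d₁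
... | tri≈ _ refl _ =
  k₁ , (λ i i<k → trans (e₁ i i<k) (e₂ i i<k)) , FirstDiff-trans d₁ d₂
... | tri> _ _ k₂<k₁ =
  k₂ , (λ i i<k₂ → trans (e₁ i (<-trans i<k₂ k₂<k₁)) (e₂ i i<k₂)) ,
  subst (λ a → FirstDiff a _) (sym (e₁ k₂ k₂<k₁)) d₂

<co-respʳ-≈co : ∀ {σ} {x y z : Str σ} → x <co y → y ≈co z → x <co z
<co-respʳ-≈co (k , e , d) y≈z = k , (λ i i<k → trans (e i i<k) (y≈z i)) , subst (FirstDiff _) (y≈z k) d

<co-respˡ-≈co : ∀ {σ} {x y z : Str σ} → x ≈co y → y <co z → x <co z
<co-respˡ-≈co x≈y (k , e , d) =
  k , (λ i i<k → trans (x≈y i) (e i i<k)) , subst (λ a → FirstDiff a _) (sym (x≈y k)) d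

≤co-trans : ∀ {σ} {x y z : Str σ} → x ≤co y → y ≤co z → x ≤co z
≤co-trans {x = x} {y} {z} (inj₁ x<y) (inj₁ y<z) = inj₁ (<co-trans {x = x} {y} {z} x<y y<z)
≤co-trans {x = x} {y} {z} (inj₁ x<y) (inj₂ y≈z) = inj₁ (<co-respʳ-≈co {x = x} {y} {z} x<y y≈z)
≤co-trans {x = x} {y} {z} (inj₂ x≈y) (inj₁ y<z) = inj₁ (<co-respˡ-≈co {x = x} {y} {z} x≈y y<z)
≤co-trans (inj₂ x≈y) (inj₂ y≈z) = inj₂ (λ i → trans (x≈y i) (y≈z i))

lookupL-injective : ∀ {A : Set} (xs ys : List A) → (∀ i → lookupL xs i ≡ lookupL ys i) → xs ≡ ys
lookupL-injective []       []       _ = refl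
lookupL-injective []       (_ ∷ _)  h with () ← h 0
lookupL-injective (_ ∷ _)  []       h with () ← h 0
lookupL-injective (x ∷ xs) (y ∷ ys) h with refl ← h 0 =
  cong (x ∷_) (lookupL-injective xs ys (λ i → h (suc i)))

word-injective : ∀ {σ} (α β : List (Fin σ)) → word α ≈co word β → α ≡ β
word-injective α β α≈β = reverse-injective (lookupL-injective (reverse α) (reverse β) α≈β)

sup≤inf-of-separated : ∀ {σ} {S T : Str σ → Set} (s t : Str σ) →
  IsSup S s → IsInf T t → (∀ x y → S x → T y → x ≤co y) → s ≤co t
sup≤inf-of-separated s t (_ , s-least) (_ , t-greatest) S≤T =
  t-greatest s λ y Ty → s-least y λ x Sx → S≤T x y Sx Ty

separated-of-sup≤inf : ∀ {σ} {S T : Str σ → Set} (s t : Str σ) →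
  IsSup S s → IsInf T t → s ≤co t → ∀ x y → S x → T y → x ≤co y
separated-of-sup≤inf s t (s-upper , _) (t-lower , _) s≤t x y Sx Ty =
  ≤co-trans {x = x} {t} {y} (≤co-trans {x = x} {s} {t} (s-upper x Sx) s≤t) (t-lower y Ty)

module _ {n σ} (A : DFA n σ) where
  open DFA A

  I-functional : ∀ {u v} α → I u α → I v α → u ≡ v
  I-functional _ Iu Iv = just-injective (trans (sym Iu) Iv)

  <A⇒IStr-separated : ∀ {u v} → u <A v → ∀ x y → IStr u x → IStr v y → x ≤co y
  <A⇒IStr-separated u<v _ _ (α , Iα , refl) (β , Iβ , refl) = inj₁ (u<v α β Iα Iβ)

  IStr-separated⇒<A : ∀ {u v} → u ≢ v → (∀ x y → IStr u x → IStr v y → x ≤co y) → u <A v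
  IStr-separated⇒<A u≢v sep α β Iα Iβ with sep (word α) (word β) (α , Iα , refl) (β , Iβ , refl)
  ... | inj₁ α<β = α<β
  ... | inj₂ α≈β with refl ← word-injective α β α≈β = ⊥-elim (u≢v (I-functional α Iα Iβ))

theorem10 : ∀ {n σ} (A : DFA n σ) → Standing A →
    ∀ (u v : Fin n) → u ≢ v →
    ∀ (supU infV : Str σ) → IsSup (DFA.IStr A u) supU → IsInf (DFA.IStr A v) infV →
    (DFA._<A_ A u v ⇔ supU ≤co infV)
theorem10 A _ u v u≢v supU infV isSup isInf = mk⇔
  (λ u<v → sup≤inf-of-separated supU infV isSup isInf (<A⇒IStr-separated A u<v))
  (λ sup≤inf → IStr-separated⇒<A A u≢v (separated-of-sup≤inf supU infV isSup isInf sup≤inf))
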